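{- For any graph $G$, $\gamma_R(G)\le 2\gamma^{p}_{I}(G)-1$.
   Context: All graphs are finite and simple with nonempty vertex sets. A perfect Italian dominating function (PID-function) of a graph $G$ is a function $f:V(G)\to\{0,1,2\}$ such that for every vertex $v$ with $f(v)=0$ we have $\sum_{u\in N(v)}f(u)=2$, where $N(v)$ is the open neighborhood of $v$. The weight of a function $f:V(G)\to\{0,1,2\}$ is $\sum_{u\in V(G)}f(u)$. The perfect Italian domination number $\gamma^{p}_{I}(G)$ is the minimum weight of a PID-function of $G$. A Roman dominating function of $G$ is a function $f:V(G)\to\{0,1,2\}$ such that every vertex $v$ with $f(v)=0$ has a neighbor $u$ with $f(u)=2$; the Roman domination number $\gamma_R(G)$ is the minimum weight of a Roman dominating function of $G$. -}

module Defs where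

open import Data.Nat using (ℕ; suc; _≤_)
open import Data.Fin using (Fin; toℕ)
open import Data.Bool using (Bool; true; false; if_then_else_)
open import Data.List using (List; map; allFin)
open import Data.Nat.ListAction using (sum)
open import Data.Product using (_×_; Σ)
open import Relation.Binary.PropositionalEquality using (_≡_)

record Graph (n : ℕ) : Set where
  field
    adj   : Fin (suc n) → Fin (suc n) → Bool
    sym   : ∀ u v → adj u v ≡ adj v u
    irrefl : ∀ v → adj v v ≡ false

open Graph public

Label : ℕ → Set
Label n = Fin (suc n) → Fin 3

val : ∀ {n} → Label n → Fin (suc n) → ℕ
val f v = toℕ (f v)

weight : ∀ {n} → Label n → ℕ
weight {n} f = sum (map (val f) (allFin (suc n)))

nbSum : ∀ {n} → Graph n → Label n → Fin (suc n) → ℕ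
nbSum {n} G f v = sum (map (λ u → if adj G v u then val f u else 0) (allFin (suc n)))

IsPID : ∀ {n} → Graph n → Label n → Set
IsPID G f = ∀ v → val f v ≡ 0 → nbSum G f v ≡ 2

IsRDF : ∀ {n} → Graph n → Label n → Set
IsRDF G f = ∀ v → val f v ≡ 0 → Σ (Fin _) λ u → (adj G v u ≡ true) × (val f u ≡ 2)

IsMinWeight : ∀ {n} → (Label n → Set) → ℕ → Set
IsMinWeight {n} P k = Σ (Label n) (λ f → P f × weight f ≡ k) × (∀ g → P g → k ≤ weight g)

IsPIDNumber : ∀ {n} → Graph n → ℕ → Set
IsPIDNumber G = IsMinWeight (IsPID G)

IsRomanNumber : ∀ {n} → Graph n → ℕ → Set
IsRomanNumber G = IsMinWeight (IsRDF G)

module Submission where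

-- Let f be a minimum PID-function and u any vertex.  The promotion of f
-- at u is the function g with g(u) = f(u) and, elsewhere, g(w) = 2 when
-- f(w) ≥ 1 and g(w) = 0 when f(w) = 0.
--  * g is always a Roman dominating function: if g(v) = 0 then f(v) = 0,
--    so the f-weight on N(v) is exactly 2.  If no neighbour of v had
--    g-value 2, every neighbour w ≠ u would have f(w) = 0 and u itself
--    (where g(u) = f(u) ≠ 2) would contribute at most 1, a total ≤ 1.
--  * If f(u) ≥ 1 then g(w) + [w = u] ≤ 2 f(w) pointwise, so
--    weight g + 1 ≤ 2 weight f.
-- A PID-function is never identically 0 (the PID condition at any vertex
-- would fail), so such a u exists, and γ_R ≤ weight g ≤ 2 γ^p_I − 1.

open import Defs
open import Data.Nat using (ℕ; zero; suc; _≤_; _+_; _*_; _∸_; z≤n; s≤s; _≤?_) renaming (_≟_ to _≟ℕ_)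
open import Data.Nat.Properties
  using (≤-refl; +-mono-≤; +-monoˡ-≤; +-monoʳ-≤; +-identityʳ;
         m+n≤o⇒m≤o∸n; +-0-commutativeMonoid; ≰⇒>; n<1⇒n≡0; module ≤-Reasoning)
open import Data.Fin using (Fin; _≟_; punchIn) renaming (zero to 0F; suc to sucF)
open import Data.Fin.Patterns using (2F)
open import Data.Fin.Properties using (any?; punchInᵢ≢i)
open import Data.Bool using (true; false; if_then_else_)
import Data.Bool as Bool
open import Data.List using (tabulate; map)
open import Data.List.Properties using (map-tabulate)
import Data.Nat.ListAction as ListSum
open import Data.Product using (Σ; _,_; proj₁; proj₂)
open import Relation.Binary.PropositionalEquality
  using (_≡_; _≢_; refl; trans; cong; cong₂; module ≡-Reasoning)
open import Relation.Nullary using (¬_; does; yes; no)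
open import Relation.Nullary.Decidable using (dec-true; dec-false; _×-dec_)
open import Data.Empty using (⊥-elim)
open import Algebra.Properties.CommutativeMonoid.Sum +-0-commutativeMonoid
  using (sum; sum-remove; ∑-distrib-+; sum-cong-≗; sum-replicate-zero)

∑ : ∀ {m} → (Fin m → ℕ) → ℕ
∑ = sum

listSum-allFin : ∀ {m} (F : Fin m → ℕ) → ListSum.sum (map F (Data.List.allFin m)) ≡ ∑ F
listSum-allFin {m} F = trans (cong ListSum.sum (map-tabulate (λ i → i) F)) (go F)
  where
  go : ∀ {k} (H : Fin k → ℕ) → ListSum.sum (tabulate H) ≡ ∑ H
  go {zero}  H = refl
  go {suc k} H = cong (H 0F +_) (go (λ i → H (sucF i)))

∑-mono-≤ : ∀ {m} {F H : Fin m → ℕ} → (∀ i → F i ≤ H i) → ∑ F ≤ ∑ H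
∑-mono-≤ {zero}  F≤H = z≤n
∑-mono-≤ {suc m} F≤H = +-mono-≤ (F≤H 0F) (∑-mono-≤ (λ i → F≤H (sucF i)))

∑-zero : ∀ {m} {F : Fin m → ℕ} → (∀ i → F i ≡ 0) → ∑ F ≡ 0
∑-zero {m} F≡0 = trans (sum-cong-≗ F≡0) (sum-replicate-zero m)

δ : ∀ {m} → Fin m → Fin m → ℕ
δ u w = if does (w ≟ u) then 1 else 0

δ-diag : ∀ {m} (u : Fin m) → δ u u ≡ 1
δ-diag u = cong (if_then 1 else 0) (dec-true (u ≟ u) refl)

δ-off : ∀ {m} {u w : Fin m} → w ≢ u → δ u w ≡ 0
δ-off {u = u} {w} w≢u = cong (if_then 1 else 0) (dec-false (w ≟ u) w≢u)

∑-δ : ∀ {m} (u : Fin (suc m)) → ∑ (δ u) ≡ 1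
∑-δ u = begin
  ∑ (δ u)                                ≡⟨ sum-remove {i = u} (δ u) ⟩
  δ u u + ∑ (λ j → δ u (punchIn u j))    ≡⟨ cong₂ _+_ (δ-diag u) (∑-zero (λ j → δ-off (punchInᵢ≢i u j))) ⟩
  1 + 0                                  ≡⟨⟩
  1                                      ∎
  where open ≡-Reasoning

weight-∑ : ∀ {n} (f : Label n) → weight f ≡ ∑ (val f)
weight-∑ f = listSum-allFin (val f)

double : Fin 3 → Fin 3
double 0F       = 0F
double (sucF _) = 2F

promote : ∀ {n} → Label n → Fin (suc n) → Label n
promote f u w = if does (w ≟ u) then f w else double (f w)

promote-zero : ∀ {n} {f : Label n} {u w : Fin (suc n)} →
  val (promote f u) w ≡ 0 → val f w ≡ 0
promote-zero {f = f} {u} {w} g≡0 with w ≟ u | f w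
... | yes _ | _      = g≡0
... | no _  | 0F     = refl
... | no _  | sucF _ = ⊥-elim (2≢0 g≡0)
  where
  2≢0 : ¬ (2 ≡ 0)
  2≢0 ()

promote-not-2 : ∀ {n} {f : Label n} {u w : Fin (suc n)} →
  val (promote f u) w ≢ 2 → val f w ≤ δ u w
promote-not-2 {f = f} {u} {w} g≢2 with w ≟ u | f w
... | yes _ | 0F             = z≤n
... | yes _ | sucF 0F        = ≤-refl
... | yes _ | sucF (sucF 0F) = ⊥-elim (g≢2 refl)
... | no _  | 0F             = z≤n
... | no _  | sucF _         = ⊥-elim (g≢2 refl)

promote-cost : ∀ {n} {f : Label n} {u : Fin (suc n)} → 1 ≤ val f u →
  ∀ w → val (promote f u) w + δ u w ≤ val f w + val f w
promote-cost {f = f} {u} fu≥1 w with w ≟ u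
... | yes refl = +-monoʳ-≤ (val f w) fu≥1
... | no _ with f w
...   | 0F      = z≤n
...   | sucF 0F = ≤-refl
...   | sucF (sucF 0F) = s≤s (s≤s z≤n)

promote-weight : ∀ {n} {f : Label n} {u : Fin (suc n)} → 1 ≤ val f u →
  weight (promote f u) + 1 ≤ 2 * weight f
promote-weight {f = f} {u} fu≥1 = begin
  weight g + 1                          ≡⟨ cong (_+ 1) (weight-∑ g) ⟩
  ∑ (val g) + 1                         ≡⟨ cong (∑ (val g) +_) (∑-δ u) ⟨
  ∑ (val g) + ∑ (δ u)                   ≡⟨ ∑-distrib-+ (val g) (δ u) ⟨
  ∑ (λ w → val g w + δ u w)             ≤⟨ ∑-mono-≤ (promote-cost {f = f} fu≥1) ⟩
  ∑ (λ w → val f w + val f w)           ≡⟨ ∑-distrib-+ (val f) (val f) ⟩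
  ∑ (val f) + ∑ (val f)                 ≡⟨ cong (λ s → ∑ (val f) + s) (+-identityʳ (∑ (val f))) ⟨
  2 * ∑ (val f)                         ≡⟨ cong (2 *_) (weight-∑ f) ⟨
  2 * weight f                          ∎
  where
  open ≤-Reasoning
  g : Label _
  g = promote f u

module _ {n : ℕ} (G : Graph n) where

  V : Set
  V = Fin (suc n)

  nbTerm : Label n → V → V → ℕ
  nbTerm f v w = if adj G v w then val f w else 0

  nbSum-∑ : (f : Label n) (v : V) → nbSum G f v ≡ ∑ (nbTerm f v)
  nbSum-∑ f v = listSum-allFin (nbTerm f v)

  nbTerm-≤ : (f : Label n) (v w : V) → nbTerm f v w ≤ val f w
  nbTerm-≤ f v w with adj G v w
  ... | true  = ≤-refl
  ... | false = z≤n

  -- A PID-function is not identically 0: otherwise every neighbourhood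
  -- sum would be 0, violating the PID condition at any vertex.
  positive-vertex : {f : Label n} → IsPID G f → Σ V (λ u → 1 ≤ val f u)
  positive-vertex {f} pid with any? (λ u → 1 ≤? val f u)
  ... | yes found = found
  ... | no none   = ⊥-elim (2≰0 (begin
      2                   ≡⟨ pid 0F (allZero 0F) ⟨
      nbSum G f 0F        ≡⟨ nbSum-∑ f 0F ⟩
      ∑ (nbTerm f 0F)     ≤⟨ ∑-mono-≤ (nbTerm-≤ f 0F) ⟩
      ∑ (val f)           ≡⟨ ∑-zero allZero ⟩
      0                   ∎))
    where
    open ≤-Reasoning
    allZero : ∀ w → val f w ≡ 0
    allZero w = n<1⇒n≡0 (≰⇒> (λ 1≤fw → none (w , 1≤fw)))
    2≰0 : ¬ (2 ≤ 0)
    2≰0 ()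

  -- If g(v) = 0 and no neighbour of v has g-value 2, each neighbour term
  -- is bounded by the point mass at u, so the neighbourhood sum of v is
  -- at most 1, whereas the PID condition at v (f(v) = 0) demands 2.
  promote-roman : {f : Label n} → IsPID G f → (u : V) → IsRDF G (promote f u)
  promote-roman {f} pid u v gv≡0
    with any? (λ w → (adj G v w Bool.≟ true) ×-dec (val (promote f u) w ≟ℕ 2))
  ... | yes found = found
  ... | no none   = ⊥-elim (2≰1 (begin
      2                   ≡⟨ pid v (promote-zero {f = f} {u} gv≡0) ⟨
      nbSum G f v         ≡⟨ nbSum-∑ f v ⟩
      ∑ (nbTerm f v)      ≤⟨ ∑-mono-≤ term≤δ ⟩
      ∑ (δ u)             ≡⟨ ∑-δ u ⟩
      1                   ∎))
    where
    open ≤-Reasoning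
    term≤δ : ∀ w → nbTerm f v w ≤ δ u w
    term≤δ w with adj G v w in v~w
    ... | true  = promote-not-2 {f = f} {u} (λ gw≡2 → none (w , v~w , gw≡2))
    ... | false = z≤n
    2≰1 : ¬ (2 ≤ 1)
    2≰1 (s≤s ())

lemma5p1 : ∀ {n} (G : Graph n) (γR γpI : ℕ) →
    IsRomanNumber G γR → IsPIDNumber G γpI → γR ≤ 2 * γpI ∸ 1
lemma5p1 G γR γpI (_ , romanMinimal) ((f , pid , wf≡γpI) , _) =
  m+n≤o⇒m≤o∸n γR (begin
    γR + 1                      ≤⟨ +-monoˡ-≤ 1 (romanMinimal g (promote-roman G pid u)) ⟩
    weight g + 1                ≤⟨ promote-weight {f = f} fu≥1 ⟩
    2 * weight f                ≡⟨ cong (2 *_) wf≡γpI ⟩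
    2 * γpI                     ∎)
  where
  open ≤-Reasoning
  u : Fin _
  u = proj₁ (positive-vertex G pid)
  fu≥1 : 1 ≤ val f u
  fu≥1 = proj₂ (positive-vertex G pid)
  g : Label _
  g = promote f u
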